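{- Let $((G,k,d),X,\langle X_L,X_R\rangle)$ be an instance of \textsc{Annotated Contraction(vc)}. Let $F_1 = E(X_L,X_R)$ and let $F_2$ be the edge set of a spanning forest of $G[X_L]$. Let $G' = (G - F_1)/F_2$, $k' = k - |F_2|$, $d' = d-|F_2|$, let $X'$ be the set of vertices of $G'$ that are images of vertices of $X$ under the contraction of $F_2$ (i.e. $X' = V(G[X]/F_2)$), and $X'_L = V(G[X_L]/F_2)$ the set of images of vertices of $X_L$. Then $((G,k,d),X,\langle X_L,X_R\rangle)$ is a yes-instance if and only if $((G',k',d'),X',\langle X'_L,X_R\rangle)$ is a yes-instance (i.e. satisfies the question of \textsc{Annotated Contraction(vc)}).
   Context: All graphs are finite, simple and undirected. For $F\subseteq E(G)$, $G/F$ is obtained by contracting all edges of $F$ (contracting $uv$ deletes $u,v$ and adds a new vertex adjacent to all former neighbours of $u$ or $v$; no loops or parallel edges); $G-F$ deletes the edges of $F$. For $S_1,S_2\subseteq V(G)$, $E(S_1,S_2)$ is the set of edges with one endpoint in $S_1$ and the other in $S_2$. $\mathrm{rank}(H)$ is the number of vertices minus the number of connected components of $H$; for $S\subseteq V(G)$, $\mathrm{rank}(S) := \mathrm{rank}(G[S])$. \textsc{Annotated Contraction(vc)}: input is a graph $G$, non-negative integers $k,d$, a minimum vertex cover $X$ of $G$, and disjoint subsets $X_L, X_R \subseteq X$; with $Y = V(G)\setminus X$, the question is whether there exist $X_s\subseteq X$ and $Y_s \subseteq Y$ such that (i) $(X\setminus X_s)\cup Y_s$ is a vertex cover of $G$,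 (ii) $\mathrm{rank}((X\setminus X_s)\cup Y_s)\ge k$, (iii) $|Y_s|-|X_s|\le k-d$, and (iv) $X_L\cap X_s=\emptyset$ and $X_R\subseteq X_s$. -}

module Defs where

open import Data.Nat using (ℕ; _≤_; _+_)
open import Data.Integer as ℤ using (ℤ; +_)
open import Data.Fin using (Fin; toℕ)
open import Data.Fin.Subset using (Subset; _∈_; _∉_; _⊆_; ∣_∣; _∪_; _─_; ∁)
open import Data.Vec using (lookup)
open import Data.Bool using (Bool; true; false; _∧_; _∨_; not)
open import Data.Bool.Properties using (∨-comm)
open import Data.List using (List; []; _∷_; _++_; length)
open import Data.List.Relation.Unary.Unique.Propositional using (Unique)
open import Data.List.Membership.Propositional using () renaming (_∈_ to _∈ˡ_)
open import Data.List.Relation.Unary.All using (All)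
open import Data.Product using (Σ; ∃; ∃-syntax; _×_; _,_)
open import Data.Sum using (_⊎_)
open import Data.Unit using (⊤)
open import Function.Bundles using (_⇔_)
open import Relation.Nullary using (¬_)
open import Relation.Binary.PropositionalEquality using (_≡_; _≢_; cong₂)

record Graph : Set where
  field
    n          : ℕ
    adj        : Fin n → Fin n → Bool
    adj-sym    : ∀ u v → adj u v ≡ adj v u
    adj-irrefl : ∀ u → adj u u ≡ false
open Graph public

Edge : (G : Graph) → Fin (n G) → Fin (n G) → Set
Edge G u v = adj G u v ≡ true

data Reach {m : ℕ} (R : Fin m → Fin m → Set) : Fin m → Fin m → Set where
  here : ∀ {u} → Reach R u u
  step : ∀ {u v w} → R u v → Reach R v w → Reach R u w

EdgeIn : (G : Graph) → Subset (n G) → Fin (n G) → Fin (n G) → Set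
EdgeIn G S u v = Edge G u v × u ∈ S × v ∈ S

-- Number of connected components of G[S] is c: a surjective labelling of the
-- vertices of S by Fin c whose fibres are exactly the connected components.
NumComponents : (G : Graph) → Subset (n G) → ℕ → Set
NumComponents G S c =
  Σ ((u : Fin (n G)) → u ∈ S → Fin c) λ comp →
    (∀ u v (u∈ : u ∈ S) (v∈ : v ∈ S) → (comp u u∈ ≡ comp v v∈) ⇔ Reach (EdgeIn G S) u v)
    × (∀ (i : Fin c) → ∃[ u ] Σ (u ∈ S) λ u∈ → comp u u∈ ≡ i)

Rank : (G : Graph) → Subset (n G) → ℕ → Set
Rank G S r = ∃[ c ] (NumComponents G S c × r + c ≡ ∣ S ∣)

VertexCover : (G : Graph) → Subset (n G) → Set
VertexCover G S = ∀ u v → Edge G u v → u ∈ S ⊎ v ∈ S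

MinVertexCover : (G : Graph) → Subset (n G) → Set
MinVertexCover G X = VertexCover G X × (∀ S → VertexCover G S → ∣ X ∣ ≤ ∣ S ∣)

Disjoint : {m : ℕ} → Subset m → Subset m → Set
Disjoint A B = ∀ u → u ∈ A → u ∉ B

-- The question of Annotated Contraction(vc) for (G,k,d), X, <XL,XR>,
-- with Y = V(G) \ X.  (k, d are integers so that k - |F2| etc. make sense.)

YesInstance : (G : Graph) → ℤ → ℤ → (X XL XR : Subset (n G)) → Set
YesInstance G k d X XL XR =
  Σ (Subset (n G)) λ Xs → Σ (Subset (n G)) λ Ys →
    Xs ⊆ X × Ys ⊆ ∁ X
    × VertexCover G ((X ─ Xs) ∪ Ys)
    × (∃[ r ] (Rank G ((X ─ Xs) ∪ Ys) r × k ℤ.≤ + r))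
    × ((+ ∣ Ys ∣) ℤ.- (+ ∣ Xs ∣) ℤ.≤ k ℤ.- d)
    × Disjoint XL Xs × XR ⊆ Xs

-- Well-formedness of an input instance (k, d are non-negative by being ℕ).
ValidInstance : (G : Graph) → (X XL XR : Subset (n G)) → Set
ValidInstance G X XL XR = MinVertexCover G X × XL ⊆ X × XR ⊆ X × Disjoint XL XR

deleteEdges : (G : Graph) → (Fin (n G) → Fin (n G) → Bool) → Graph
deleteEdges G F = record
  { n = n G
  ; adj = λ u v → adj G u v ∧ not (F u v ∨ F v u)
  ; adj-sym = λ u v → cong₂ (λ a b → a ∧ not b) (adj-sym G u v) (∨-comm (F u v) (F v u))
  ; adj-irrefl = λ u → cong₂ (λ a b → a ∧ b) (adj-irrefl G u) _≡_.refl
  }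

between : {m : ℕ} → Subset m → Subset m → Fin m → Fin m → Bool
between A B u v = lookup A u ∧ lookup B v

-- Edge sets given as lists of pairs (u , v) with toℕ u < toℕ v, no repeats.

EdgeOfList : {m : ℕ} → List (Fin m × Fin m) → Fin m → Fin m → Set
EdgeOfList L u v = (u , v) ∈ˡ L ⊎ (v , u) ∈ˡ L

IsWalk : {m : ℕ} → (Fin m → Fin m → Set) → List (Fin m) → Set
IsWalk R [] = ⊤
IsWalk R (x ∷ []) = ⊤
IsWalk R (x ∷ y ∷ xs) = R x y × IsWalk R (y ∷ xs)

HasCycle : {m : ℕ} → (Fin m → Fin m → Set) → Set
HasCycle {m} R = Σ (Fin m) λ x → Σ (List (Fin m)) λ vs →
  2 ≤ length vs × Unique (x ∷ vs) × IsWalk R (x ∷ vs ++ x ∷ [])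

SpanningForest : (G : Graph) → Subset (n G) → List (Fin (n G) × Fin (n G)) → Set
SpanningForest G S L =
  Unique L
  × All (λ e → let u = Data.Product.proj₁ e ; v = Data.Product.proj₂ e in
           toℕ u Data.Nat.< toℕ v × EdgeIn G S u v) L
  × ¬ HasCycle (EdgeOfList L)
  × (∀ u v → u ∈ S → v ∈ S → Reach (EdgeIn G S) u v → Reach (EdgeOfList L) u v)

IsContraction : (H : Graph) → (Fin (n H) → Fin (n H) → Set) →
                (G' : Graph) → (Fin (n H) → Fin (n G')) → Set
IsContraction H F G' π =
  (∀ a → ∃[ u ] π u ≡ a)
  × (∀ u v → (π u ≡ π v) ⇔ Reach F u v)
  × (∀ a b → Edge G' a b ⇔ (a ≢ b × ∃[ u ] ∃[ v ] (π u ≡ a × π v ≡ b × Edge H u v)))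

IsImage : {m m' : ℕ} → (Fin m → Fin m') → Subset m → Subset m' → Set
IsImage π A I = ∀ a → a ∈ I ⇔ (∃[ u ] (u ∈ A × π u ≡ a))

-- The deleted edges E(XL, XR) and the edges inside a class of the contraction all have an
-- endpoint in XL, and XL lies in every candidate cover S = (X ─ Xs) ∪ Ys, which misses XR.
-- Hence S is a vertex cover of G iff its image S′ is one of G′, and the components of G[S]
-- and G′[S′] correspond. The map π only identifies vertices joined in the forest F₂ ⊆ G[XL],
-- so it is injective off XL, and since a forest with f edges has f fewer components than
-- vertices, |S| = |S′| + |F₂|: the rank drops by exactly |F₂|, while Xs and Ys, which avoid
-- XL, keep their sizes. Solutions therefore correspond through images and preimages, with k
-- and d both lowered by |F₂|.

module Submission where

open import Defs
open import Data.Bool using (true; false)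
open import Data.Bool.Properties using (∧-conicalˡ; ∧-conicalʳ; ∧-identityʳ)
open import Data.Empty using (⊥-elim)
open import Data.Fin using (Fin; zero; suc; toℕ)
open import Data.Fin.Properties using (_≟_; injective⇒≤; suc-injective)
open import Data.Fin.Subset using (Subset; _∈_; _∉_; _⊆_; ∣_∣; _∪_; _─_; ∁; ⊤)
open import Data.Fin.Subset.Properties
  using (∣⊤∣≡n; ∣p∣≤n; ∣∁p∣≡n∸∣p∣; x∈p∪q⁻; x∈p∪q⁺; x∈p∧x∉q⇒x∈p─q; x∈∁p⇒x∉p; x∉p⇒x∈∁p)
open import Data.Integer as ℤ using (ℤ; +_; _-_)
import Data.Integer.Properties as ℤ
import Data.Integer.Tactic.RingSolver as ℤ-Solver
open import Data.List using (List; []; _∷_; _++_; length)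
import Data.List.Membership.DecPropositional as DecMembership
open import Data.List.Membership.Propositional using () renaming (_∈_ to _∈ˡ_)
open import Data.List.Relation.Unary.All as All using (All; []; _∷_)
open import Data.List.Relation.Unary.All.Properties.Core using (¬Any⇒All¬)
open import Data.List.Relation.Unary.AllPairs using ([]; _∷_)
open import Data.List.Relation.Unary.Any using (here; there)
open import Data.List.Relation.Unary.Unique.Propositional using (Unique)
open import Data.Nat as ℕ using (ℕ; zero; suc; _≤_; _<_; _+_; _∸_; z≤n; s≤s)
import Data.Nat.Properties as ℕ
open import Algebra.Properties.CommutativeSemigroup ℕ.+-commutativeSemigroup
  using (xy∙z≈xz∙y)
open import Data.Product using (Σ; ∃; ∃-syntax; _×_; _,_; proj₁; proj₂; map₁)
open import Data.Product.Function.NonDependent.Propositional using (_×-⇔_)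
open import Data.Sum as Sum using (_⊎_; inj₁; inj₂)
open import Data.Sum.Function.Propositional using (_⊎-⇔_)
open import Data.Unit using (tt)
open import Data.Vec using (_∷_; lookup; tabulate)
import Data.Vec.Base as Vec
open import Data.Vec.Properties using ([]=⇒lookup; lookup⇒[]=; lookup∘tabulate)
open import Function.Bundles using (_⇔_; mk⇔; Equivalence)
open import Function.Properties.Equivalence using ()
  renaming (refl to ⇔-refl; trans to ⇔-trans; sym to ⇔-sym)
open import Function.Related.TypeIsomorphisms using (¬-cong-⇔)
open import Relation.Binary.PropositionalEquality
open import Relation.Nullary using (¬_; Dec; yes; no)
open import Relation.Nullary.Decidable using (map′; _×-dec_; _⊎-dec_)

open Equivalence using (to; from)

module _ {m : ℕ} {R : Fin m → Fin m → Set} where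

  reach-≡ : ∀ {u v} → u ≡ v → Reach R u v
  reach-≡ refl = here

  reach-trans : ∀ {u v w} → Reach R u v → Reach R v w → Reach R u w
  reach-trans here q = q
  reach-trans (step e p) q = step e (reach-trans p q)

  reach-sym : (∀ {u v} → R u v → R v u) → ∀ {u v} → Reach R u v → Reach R v u
  reach-sym R-sym here = here
  reach-sym R-sym (step e p) = reach-trans (reach-sym R-sym p) (step (R-sym e) here)

reach-map : ∀ {m} {R Q : Fin m → Fin m → Set} →
            (∀ {u v} → R u v → Q u v) → ∀ {u v} → Reach R u v → Reach Q u v
reach-map f here = here
reach-map f (step e p) = step (f e) (reach-map f p)

-- Counting subsets

private
  enum : ∀ {n} (p : Subset n) → Fin ∣ p ∣ → Fin n
  enum (true ∷ p) zero = zero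
  enum (true ∷ p) (suc i) = suc (enum p i)
  enum (false ∷ p) i = suc (enum p i)

  enum-∈ : ∀ {n} (p : Subset n) i → enum p i ∈ p
  enum-∈ (true ∷ p) zero = Vec.here
  enum-∈ (true ∷ p) (suc i) = Vec.there (enum-∈ p i)
  enum-∈ (false ∷ p) i = Vec.there (enum-∈ p i)

  enum-injective : ∀ {n} (p : Subset n) {i j} → enum p i ≡ enum p j → i ≡ j
  enum-injective (true ∷ p) {zero} {zero} _ = refl
  enum-injective (true ∷ p) {suc i} {suc j} e = cong suc (enum-injective p (suc-injective e))
  enum-injective (false ∷ p) e = enum-injective p (suc-injective e)

  index : ∀ {n} (p : Subset n) {u} → u ∈ p → Fin ∣ p ∣
  index (true ∷ p) Vec.here = zero
  index (true ∷ p) (Vec.there u∈p) = suc (index p u∈p)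
  index (false ∷ p) (Vec.there u∈p) = index p u∈p

  index-injective : ∀ {n} (p : Subset n) {u v} (u∈p : u ∈ p) (v∈p : v ∈ p) →
                    index p u∈p ≡ index p v∈p → u ≡ v
  index-injective (true ∷ p) Vec.here Vec.here _ = refl
  index-injective (true ∷ p) (Vec.there u∈p) (Vec.there v∈p) e =
    cong suc (index-injective p u∈p v∈p (suc-injective e))
  index-injective (false ∷ p) (Vec.there u∈p) (Vec.there v∈p) e =
    cong suc (index-injective p u∈p v∈p e)

injectiveOn⇒∣p∣≤∣q∣ : ∀ {n m} {p : Subset n} {q : Subset m} (f : Fin n → Fin m) →
                      (∀ {u} → u ∈ p → f u ∈ q) →
                      (∀ {u v} → u ∈ p → v ∈ p → f u ≡ f v → u ≡ v) →
                      ∣ p ∣ ≤ ∣ q ∣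
injectiveOn⇒∣p∣≤∣q∣ {p = p} {q} f f∈q f-inj = injective⇒≤ {f = g} λ {i} {j} gi≡gj →
  enum-injective p (f-inj (enum-∈ p i) (enum-∈ p j)
    (index-injective q (f∈q (enum-∈ p i)) (f∈q (enum-∈ p j)) gi≡gj))
  where
  g : Fin ∣ p ∣ → Fin ∣ q ∣
  g i = index q (f∈q (enum-∈ p i))

-- Subsets along a surjection

∁⇔∉ : ∀ {n} {p : Subset n} {x} → x ∈ ∁ p ⇔ x ∉ p
∁⇔∉ = mk⇔ x∈∁p⇒x∉p x∉p⇒x∈∁p

∪⇔⊎ : ∀ {n} {p q : Subset n} {x} → x ∈ p ∪ q ⇔ (x ∈ p ⊎ x ∈ q)
∪⇔⊎ {p = p} {q} = mk⇔ (x∈p∪q⁻ p q) x∈p∪q⁺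

─⇔×∉ : ∀ {n} {p q : Subset n} {x} → x ∈ p ─ q ⇔ (x ∈ p × x ∉ q)
─⇔×∉ {p = p} {q} = mk⇔ (x∈p─q⁻ p q) (λ (x∈p , x∉q) → x∈p∧x∉q⇒x∈p─q x∈p x∉q)
  where
  x∈p─q⁻ : ∀ {n} (p q : Subset n) {x} → x ∈ p ─ q → x ∈ p × x ∉ q
  x∈p─q⁻ (true ∷ p) (false ∷ q) Vec.here = Vec.here , λ ()
  x∈p─q⁻ (false ∷ p) (true ∷ q) {zero} ()
  x∈p─q⁻ (false ∷ p) (false ∷ q) {zero} ()
  x∈p─q⁻ (_ ∷ p) (_ ∷ q) (Vec.there x∈p─q) =
    let (x∈p , x∉q) = x∈p─q⁻ p q x∈p─q in Vec.there x∈p , λ { (Vec.there x∈q) → x∉q x∈q }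

pullback : ∀ {n m} → (Fin n → Fin m) → Subset m → Subset n
pullback g A = tabulate (λ x → lookup A (g x))

∈-pullback : ∀ {n m} (g : Fin n → Fin m) {A x} → x ∈ pullback g A ⇔ g x ∈ A
∈-pullback g {A} {x} = mk⇔
  (λ x∈ → lookup⇒[]= (g x) A (trans (sym (lookup∘tabulate _ x)) ([]=⇒lookup x∈)))
  (λ gx∈ → lookup⇒[]= x _ (trans (lookup∘tabulate _ x) ([]=⇒lookup gx∈)))

module Quotient {m m′ : ℕ} (π : Fin m → Fin m′) (onto : ∀ a → ∃[ u ] π u ≡ a) where

  section : Fin m′ → Fin m
  section a = proj₁ (onto a)

  π∘section : ∀ a → π (section a) ≡ a
  π∘section a = proj₂ (onto a)

  section-injective : ∀ {a b} → section a ≡ section b → a ≡ b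
  section-injective {a} {b} eq = trans (sym (π∘section a)) (trans (cong π eq) (π∘section b))

  Corresponds : Subset m → Subset m′ → Set
  Corresponds A A′ = ∀ u → u ∈ A ⇔ π u ∈ A′

  Saturated : Subset m → Set
  Saturated A = ∀ {u v} → π u ≡ π v → u ∈ A → v ∈ A

  InjectiveOn : Subset m → Set
  InjectiveOn A = ∀ {u v} → u ∈ A → v ∈ A → π u ≡ π v → u ≡ v

  image : Subset m → Subset m′
  image = pullback section

  preimage : Subset m′ → Subset m
  preimage = pullback π

  ∈-section : ∀ {A A′} → Corresponds A A′ → ∀ a → a ∈ A′ ⇔ section a ∈ A
  ∈-section {A′ = A′} A~A′ a = mk⇔
    (λ a∈A′ → from (A~A′ (section a)) (subst (_∈ A′) (sym (π∘section a)) a∈A′))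
    (λ s∈A → subst (_∈ A′) (π∘section a) (to (A~A′ (section a)) s∈A))

  preimage-corresponds : ∀ A′ → Corresponds (preimage A′) A′
  preimage-corresponds A′ u = ∈-pullback π

  image-corresponds : ∀ {A} → Saturated A → Corresponds A (image A)
  image-corresponds saturated u = mk⇔
    (λ u∈A → from (∈-pullback section) (saturated (sym (π∘section (π u))) u∈A))
    (λ πu∈ → saturated (π∘section (π u)) (to (∈-pullback section) πu∈))

  isImage⇒corresponds : ∀ {A A′} → IsImage π A A′ → Saturated A → Corresponds A A′
  isImage⇒corresponds isImage saturated u = mk⇔
    (λ u∈A → from (isImage (π u)) (u , u∈A , refl))
    (λ πu∈A′ → let (w , w∈A , πw≡πu) = to (isImage (π u)) πu∈A′ in saturated πw≡πu w∈A)

  corresponds-∁ : ∀ {A A′} → Corresponds A A′ → Corresponds (∁ A) (∁ A′)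
  corresponds-∁ A~A′ u = ⇔-trans ∁⇔∉ (⇔-trans (¬-cong-⇔ (A~A′ u)) (⇔-sym ∁⇔∉))

  corresponds-─ : ∀ {A A′ B B′} → Corresponds A A′ → Corresponds B B′ →
                  Corresponds (A ─ B) (A′ ─ B′)
  corresponds-─ A~A′ B~B′ u =
    ⇔-trans ─⇔×∉ (⇔-trans (A~A′ u ×-⇔ ¬-cong-⇔ (B~B′ u)) (⇔-sym ─⇔×∉))

  corresponds-∪ : ∀ {A A′ B B′} → Corresponds A A′ → Corresponds B B′ →
                  Corresponds (A ∪ B) (A′ ∪ B′)
  corresponds-∪ A~A′ B~B′ u = ⇔-trans ∪⇔⊎ (⇔-trans (A~A′ u ⊎-⇔ B~B′ u) (⇔-sym ∪⇔⊎))

  ⊆-transfer : ∀ {A A′ B B′} → Corresponds A A′ → Corresponds B B′ → A ⊆ B ⇔ A′ ⊆ B′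
  ⊆-transfer A~A′ B~B′ = mk⇔
    (λ A⊆B {a} a∈A′ → from (∈-section B~B′ a) (A⊆B (to (∈-section A~A′ a) a∈A′)))
    (λ A′⊆B′ {u} u∈A → from (B~B′ u) (A′⊆B′ (to (A~A′ u) u∈A)))

  disjoint-transfer : ∀ {A A′ B B′} → Corresponds A A′ → Corresponds B B′ →
                      Disjoint A B ⇔ Disjoint A′ B′
  disjoint-transfer A~A′ B~B′ = mk⇔
    (λ A∩B=∅ a a∈A′ a∈B′ →
       A∩B=∅ (section a) (to (∈-section A~A′ a) a∈A′) (to (∈-section B~B′ a) a∈B′))
    (λ A′∩B′=∅ u u∈A u∈B → A′∩B′=∅ (π u) (to (A~A′ u) u∈A) (to (B~B′ u) u∈B))

  ∣∣-transfer : ∀ {A A′} → Corresponds A A′ → InjectiveOn A → ∣ A ∣ ≡ ∣ A′ ∣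
  ∣∣-transfer A~A′ injective = ℕ.≤-antisym
    (injectiveOn⇒∣p∣≤∣q∣ π (λ {u} → to (A~A′ u)) injective)
    (injectiveOn⇒∣p∣≤∣q∣ section (λ {a} → to (∈-section A~A′ a)) (λ _ _ → section-injective))

  -- Count the complements, on which π is a bijection.
  ∣∣-transfer-∁ : ∀ {A A′ f} → m ≡ m′ + f → Corresponds A A′ → InjectiveOn (∁ A) →
                  ∣ A ∣ ≡ ∣ A′ ∣ + f
  ∣∣-transfer-∁ {A} {A′} {f} m≡m′+f A~A′ injective = ℕ.+-cancelʳ-≡ (m ∸ ∣ A ∣) _ _ (begin
    ∣ A ∣ + (m ∸ ∣ A ∣)          ≡⟨ ℕ.m+[n∸m]≡n (∣p∣≤n A) ⟩
    m                             ≡⟨ m≡m′+f ⟩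
    m′ + f                        ≡⟨ cong (_+ f) (sym (ℕ.m+[n∸m]≡n (∣p∣≤n A′))) ⟩
    ∣ A′ ∣ + (m′ ∸ ∣ A′ ∣) + f    ≡⟨ cong (λ x → ∣ A′ ∣ + x + f) complements ⟩
    ∣ A′ ∣ + (m ∸ ∣ A ∣) + f      ≡⟨ xy∙z≈xz∙y ∣ A′ ∣ _ f ⟩
    ∣ A′ ∣ + f + (m ∸ ∣ A ∣)      ∎)
    where
    open ≡-Reasoning
    complements : m′ ∸ ∣ A′ ∣ ≡ m ∸ ∣ A ∣
    complements = begin
      m′ ∸ ∣ A′ ∣   ≡⟨ ∣∁p∣≡n∸∣p∣ A′ ⟨
      ∣ ∁ A′ ∣      ≡⟨ ∣∣-transfer (corresponds-∁ A~A′) injective ⟨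
      ∣ ∁ A ∣       ≡⟨ ∣∁p∣≡n∸∣p∣ A ⟩
      m ∸ ∣ A ∣     ∎

-- Forests given as edge lists

IsQuotient : ∀ {m m′} → (Fin m → Fin m′) → (Fin m → Fin m → Set) → Set
IsQuotient π R = (∀ a → ∃[ u ] π u ≡ a) × (∀ u v → (π u ≡ π v) ⇔ R u v)

Oriented : ∀ {m} → Fin m × Fin m → Set
Oriented e = toℕ (proj₁ e) < toℕ (proj₂ e)

lastVertex : ∀ {m} → Fin m → List (Fin m) → Fin m
lastVertex u [] = u
lastVertex u (w ∷ ws) = lastVertex w ws

module _ {m : ℕ} {R : Fin m → Fin m → Set} where

  open DecMembership (_≟_ {m}) using (_∈?_)

  SimplePath : Fin m → Fin m → Set
  SimplePath u v =
    Σ (List (Fin m)) λ ws → Unique (u ∷ ws) × IsWalk R (u ∷ ws) × lastVertex u ws ≡ v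

  private
    suffixFrom : ∀ {u w ws} → IsWalk R (w ∷ ws) → Unique (w ∷ ws) → u ∈ˡ (w ∷ ws) →
                 SimplePath u (lastVertex w ws)
    suffixFrom {ws = ws} walk unique (here refl) = ws , unique , walk , refl
    suffixFrom {ws = _ ∷ _} (_ , walk) (_ ∷ unique) (there u∈ws) = suffixFrom walk unique u∈ws

  -- If u already lies on the simple path from w, cut that path back to start at u.
  reach⇒simplePath : ∀ {u v} → Reach R u v → SimplePath u v
  reach⇒simplePath here = [] , [] ∷ [] , tt , refl
  reach⇒simplePath {u} (step {v = w} e p) with reach⇒simplePath p
  ... | ws , unique , walk , end with u ∈? (w ∷ ws)
  ... | yes u∈ws = let (ws′ , unique′ , walk′ , end′) = suffixFrom walk unique u∈ws
                   in ws′ , unique′ , walk′ , trans end′ end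
  ... | no  u∉ws = w ∷ ws , ¬Any⇒All¬ _ u∉ws ∷ unique , (e , walk) , end

  isWalk-∷ʳ : ∀ u ws {v} → IsWalk R (u ∷ ws) → R (lastVertex u ws) v → IsWalk R (u ∷ ws ++ v ∷ [])
  isWalk-∷ʳ u [] _ e = e , tt
  isWalk-∷ʳ u (w ∷ ws) (e , walk) e′ = e , isWalk-∷ʳ w ws walk e′

isWalk-map : ∀ {m} {R Q : Fin m → Fin m → Set} → (∀ {u v} → R u v → Q u v) →
             ∀ vs → IsWalk R vs → IsWalk Q vs
isWalk-map f [] _ = tt
isWalk-map f (_ ∷ []) _ = tt
isWalk-map f (_ ∷ v ∷ vs) (e , walk) = f e , isWalk-map f (v ∷ vs) walk

module _ {m : ℕ} where

  Connected : List (Fin m × Fin m) → Fin m → Fin m → Set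
  Connected L = Reach (EdgeOfList L)

  Through : Fin m → Fin m → List (Fin m × Fin m) → Fin m → Fin m → Set
  Through a b L u v = Connected L u a × Connected L b v

  edgeOfList-∷ : ∀ {e} {L : List (Fin m × Fin m)} {u v} → EdgeOfList L u v → EdgeOfList (e ∷ L) u v
  edgeOfList-∷ (inj₁ e) = inj₁ (there e)
  edgeOfList-∷ (inj₂ e) = inj₂ (there e)

  connected-sym : ∀ {L u v} → Connected L u v → Connected L v u
  connected-sym = reach-sym Sum.swap

  connected-∷ : ∀ {e L u v} → Connected L u v → Connected (e ∷ L) u v
  connected-∷ = reach-map edgeOfList-∷

  connected-[] : ∀ {u v} → Connected [] u v → u ≡ v
  connected-[] here = refl
  connected-[] (step (inj₁ ()) _)
  connected-[] (step (inj₂ ()) _)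

  Connected⁺ : Fin m → Fin m → List (Fin m × Fin m) → Fin m → Fin m → Set
  Connected⁺ a b L u v = Connected L u v ⊎ Through a b L u v ⊎ Through b a L u v

  connected-∷⁻ : ∀ {a b L u v} → Connected ((a , b) ∷ L) u v → Connected⁺ a b L u v
  connected-∷⁻ here = inj₁ here
  connected-∷⁻ {a} {b} {L} (step e p) = prepend e (connected-∷⁻ p)
    where
    prepend : ∀ {u w v} → EdgeOfList ((a , b) ∷ L) u w →
              Connected⁺ a b L w v → Connected⁺ a b L u v
    prepend (inj₁ (here refl)) (inj₁ b~v) = inj₂ (inj₁ (here , b~v))
    prepend (inj₁ (here refl)) (inj₂ (inj₁ (b~a , b~v))) =
      inj₁ (reach-trans (connected-sym b~a) b~v)
    prepend (inj₁ (here refl)) (inj₂ (inj₂ (_ , a~v))) = inj₁ a~v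
    prepend (inj₂ (here refl)) (inj₁ a~v) = inj₂ (inj₂ (here , a~v))
    prepend (inj₂ (here refl)) (inj₂ (inj₁ (_ , b~v))) = inj₁ b~v
    prepend (inj₂ (here refl)) (inj₂ (inj₂ (a~b , a~v))) =
      inj₁ (reach-trans (connected-sym a~b) a~v)
    prepend (inj₁ (there e)) = Sum.map (step e′) (Sum.map (map₁ (step e′)) (map₁ (step e′)))
      where e′ = inj₁ e
    prepend (inj₂ (there e)) = Sum.map (step e′) (Sum.map (map₁ (step e′)) (map₁ (step e′)))
      where e′ = inj₂ e

  connected-∷⁺ : ∀ {a b L u v} → Connected⁺ a b L u v → Connected ((a , b) ∷ L) u v
  connected-∷⁺ (inj₁ u~v) = connected-∷ u~v
  connected-∷⁺ (inj₂ (inj₁ (u~a , b~v))) =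
    reach-trans (connected-∷ u~a) (step (inj₁ (here refl)) (connected-∷ b~v))
  connected-∷⁺ (inj₂ (inj₂ (u~b , a~v))) =
    reach-trans (connected-∷ u~b) (step (inj₂ (here refl)) (connected-∷ a~v))

  connected? : ∀ L u v → Dec (Connected L u v)
  connected? [] u v = map′ reach-≡ connected-[] (u ≟ v)
  connected? ((a , b) ∷ L) u v = map′ connected-∷⁺ connected-∷⁻
    (connected? L u v ⊎-dec (connected? L u a ×-dec connected? L b v)
                      ⊎-dec (connected? L u b ×-dec connected? L a v))

  acyclic-∷⁻ : ∀ {e L} → ¬ HasCycle (EdgeOfList (e ∷ L)) → ¬ HasCycle (EdgeOfList L)
  acyclic-∷⁻ acyclic (x , vs , 2≤∣vs∣ , unique , walk) =
    acyclic (x , vs , 2≤∣vs∣ , unique , isWalk-map edgeOfList-∷ (x ∷ vs ++ x ∷ []) walk)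

  -- A simple a–b path in L closes a cycle with the edge ab; paths with at most one edge are
  -- ruled out by orientation and uniqueness of the edges.
  acyclic⇒¬connected : ∀ {a b L} → Unique ((a , b) ∷ L) → All Oriented ((a , b) ∷ L) →
                       ¬ HasCycle (EdgeOfList ((a , b) ∷ L)) → ¬ Connected L a b
  acyclic⇒¬connected {a} {b} {L} (ab∉L ∷ _) (a<b ∷ oriented) acyclic a~b
    with reach⇒simplePath a~b
  ... | [] , _ , _ , refl = ℕ.<-irrefl refl a<b
  ... | _ ∷ [] , _ , (inj₁ ab∈L , _) , refl = All.lookup ab∉L ab∈L refl
  ... | _ ∷ [] , _ , (inj₂ ba∈L , _) , refl = ℕ.<-asym a<b (All.lookup oriented ba∈L)
  ... | ws@(_ ∷ _ ∷ _) , unique , walk , end =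
    acyclic (a , ws , s≤s (s≤s z≤n) , unique ,
             isWalk-∷ʳ a ws (isWalk-map edgeOfList-∷ (a ∷ ws) walk) closing)
    where
    closing : EdgeOfList ((a , b) ∷ L) (lastVertex a ws) a
    closing = subst (λ z → EdgeOfList ((a , b) ∷ L) z a) (sym end) (inj₂ (here refl))

  -- Removing the edge ab splits one class in two; the side of b gets the fresh label zero.
  detach : ∀ {n′ a b L} {π : Fin m → Fin n′} → IsQuotient π (Connected ((a , b) ∷ L)) →
           ¬ Connected L a b → Σ (Fin m → Fin (suc n′)) λ π′ → IsQuotient π′ (Connected L)
  detach {n′} {a} {b} {L} {π} (onto , fibres) a≁b = π′ , onto′ , fibres′
    where
    label : ∀ {P : Set} → Dec P → Fin n′ → Fin (suc n′)
    label (yes _) _ = zero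
    label (no _) i = suc i

    π′ : Fin m → Fin (suc n′)
    π′ u = label (connected? L u b) (π u)

    π′-zero : ∀ {u} → Connected L u b → π′ u ≡ zero
    π′-zero {u} u~b with connected? L u b
    ... | yes _ = refl
    ... | no u≁b = ⊥-elim (u≁b u~b)

    π′-suc : ∀ {u} → ¬ Connected L u b → π′ u ≡ suc (π u)
    π′-suc {u} u≁b with connected? L u b
    ... | yes u~b = ⊥-elim (u≁b u~b)
    ... | no _ = refl

    onto′ : ∀ i → ∃[ u ] π′ u ≡ i
    onto′ zero = b , π′-zero here
    onto′ (suc i) with onto i
    ... | u , refl with connected? L u b
    ... | no u≁b = u , π′-suc u≁b
    ... | yes u~b = a , trans (π′-suc a≁b) (cong suc (from (fibres a u) a~u))
      where
      a~u : Connected ((a , b) ∷ L) a u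
      a~u = step (inj₁ (here refl)) (connected-∷ (connected-sym u~b))

    fibres′ : ∀ u v → (π′ u ≡ π′ v) ⇔ Connected L u v
    fibres′ u v with connected? L u b | connected? L v b
    ... | yes u~b | yes v~b = mk⇔ (λ _ → reach-trans u~b (connected-sym v~b)) (λ _ → refl)
    ... | yes u~b | no v≁b = mk⇔ (λ ()) (λ u~v → ⊥-elim (v≁b (reach-trans (connected-sym u~v) u~b)))
    ... | no u≁b | yes v~b = mk⇔ (λ ()) (λ u~v → ⊥-elim (u≁b (reach-trans u~v v~b)))
    ... | no u≁b | no v≁b = mk⇔
      (λ πu≡πv → avoiding-ab (connected-∷⁻ (to (fibres u v) (suc-injective πu≡πv))))
      (λ u~v → cong suc (from (fibres u v) (connected-∷ u~v)))
      where
      avoiding-ab : Connected⁺ a b L u v → Connected L u v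
      avoiding-ab (inj₁ u~v) = u~v
      avoiding-ab (inj₂ (inj₁ (_ , b~v))) = ⊥-elim (v≁b (connected-sym b~v))
      avoiding-ab (inj₂ (inj₂ (u~b , _))) = ⊥-elim (u≁b u~b)

  forest-contraction-size : ∀ {n′} L → Unique L → All Oriented L → ¬ HasCycle (EdgeOfList L) →
                            {π : Fin m → Fin n′} → IsQuotient π (Connected L) → m ≡ n′ + length L
  forest-contraction-size {n′} [] _ _ _ {π} (onto , fibres) =
    trans (ℕ.≤-antisym (injective⇒≤ π-injective) (injective⇒≤ (Quotient.section-injective π onto)))
          (sym (ℕ.+-identityʳ n′))
    where
    π-injective : ∀ {u v} → π u ≡ π v → u ≡ v
    π-injective {u} {v} πu≡πv = connected-[] (to (fibres u v) πu≡πv)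
  forest-contraction-size {n′} (_ ∷ L) unique@(_ ∷ unique′) oriented@(_ ∷ oriented′)
                          acyclic quotient
    with detach quotient (acyclic⇒¬connected unique oriented acyclic)
  ... | _ , quotient′ =
    trans (forest-contraction-size L unique′ oriented′ (acyclic-∷⁻ acyclic) quotient′)
          (sym (ℕ.+-suc n′ (length L)))

-- Components and rank under a quotient map

module _ {G G′ : Graph} {π : Fin (n G) → Fin (n G′)} (onto : ∀ a → ∃[ u ] π u ≡ a) where

  open Quotient π onto

  numComponents-transfer :
    ∀ {S S′} → Corresponds S S′ →
    (∀ {u v} → u ∈ S → v ∈ S → Reach (EdgeIn G S) u v ⇔ Reach (EdgeIn G′ S′) (π u) (π v)) →
    ∀ {c} → NumComponents G S c ⇔ NumComponents G′ S′ c
  numComponents-transfer {S} {S′} S~S′ reach~ {c} = mk⇔ forward backward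
    where
    forward : NumComponents G S c → NumComponents G′ S′ c
    forward (comp , fibres , comp-onto) = comp′ , fibres′ , comp′-onto
      where
      section∈ : ∀ {a} → a ∈ S′ → section a ∈ S
      section∈ {a} = to (∈-section S~S′ a)

      comp′ : ∀ a → a ∈ S′ → Fin c
      comp′ a a∈ = comp (section a) (section∈ a∈)

      fibres′ : ∀ a b (a∈ : a ∈ S′) (b∈ : b ∈ S′) →
                (comp′ a a∈ ≡ comp′ b b∈) ⇔ Reach (EdgeIn G′ S′) a b
      fibres′ a b a∈ b∈ = mk⇔
        (λ eq → subst₂ (Reach (EdgeIn G′ S′)) (π∘section a) (π∘section b)
                  (to (reach~ (section∈ a∈) (section∈ b∈)) (to (fibres _ _ _ _) eq)))
        (λ a~b → from (fibres _ _ _ _) (from (reach~ (section∈ a∈) (section∈ b∈))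
                  (subst₂ (Reach (EdgeIn G′ S′)) (sym (π∘section a)) (sym (π∘section b)) a~b)))

      comp′-onto : ∀ i → ∃[ a ] Σ (a ∈ S′) λ a∈ → comp′ a a∈ ≡ i
      comp′-onto i with comp-onto i
      ... | u , u∈ , refl =
        π u , πu∈ , from (fibres _ _ _ _) (from (reach~ (section∈ πu∈) u∈) πsπu~πu)
        where
        πu∈ : π u ∈ S′
        πu∈ = to (S~S′ u) u∈

        πsπu~πu : Reach (EdgeIn G′ S′) (π (section (π u))) (π u)
        πsπu~πu = reach-≡ (π∘section (π u))

    backward : NumComponents G′ S′ c → NumComponents G S c
    backward (comp′ , fibres′ , comp′-onto) = comp , fibres , comp-onto
      where
      comp : ∀ u → u ∈ S → Fin c
      comp u u∈ = comp′ (π u) (to (S~S′ u) u∈)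

      fibres : ∀ u v (u∈ : u ∈ S) (v∈ : v ∈ S) →
               (comp u u∈ ≡ comp v v∈) ⇔ Reach (EdgeIn G S) u v
      fibres u v u∈ v∈ = ⇔-trans (fibres′ _ _ _ _) (⇔-sym (reach~ u∈ v∈))

      comp-onto : ∀ i → ∃[ u ] Σ (u ∈ S) λ u∈ → comp u u∈ ≡ i
      comp-onto i with comp′-onto i
      ... | a , a∈ , refl =
        section a , to (∈-section S~S′ a) a∈ , from (fibres′ _ _ _ _) (reach-≡ (π∘section a))

numComponents≤∣S∣ : ∀ {G S c} → NumComponents G S c → c ≤ ∣ S ∣
numComponents≤∣S∣ {S = S} {c} (comp , fibres , onto) =
  subst (_≤ ∣ S ∣) (∣⊤∣≡n c)
    (injectiveOn⇒∣p∣≤∣q∣ {p = ⊤} rep (λ {i} _ → proj₁ (proj₂ (onto i))) rep-injective)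
  where
  rep : Fin c → Fin _
  rep i = proj₁ (onto i)

  rep-injective : ∀ {i j} → i ∈ ⊤ → j ∈ ⊤ → rep i ≡ rep j → i ≡ j
  rep-injective {i} {j} _ _ eq with onto i | onto j
  ... | u , u∈S , refl | v , v∈S , refl = from (fibres u v u∈S v∈S) (reach-≡ eq)

i-j≤k⇔i≤k+j : ∀ {i j k} → i - j ℤ.≤ k ⇔ i ℤ.≤ k ℤ.+ j
i-j≤k⇔i≤k+j {i} {j} {k} = mk⇔
  (λ i-j≤k → subst (ℤ._≤ k ℤ.+ j) (i-j+j≡i i j) (ℤ.+-monoˡ-≤ j i-j≤k))
  (λ i≤k+j → subst (i - j ℤ.≤_) (i+j-j≡i k j) (ℤ.+-monoˡ-≤ (ℤ.- j) i≤k+j))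
  where
  i-j+j≡i : ∀ i j → i - j ℤ.+ j ≡ i
  i-j+j≡i = ℤ-Solver.solve-∀

  i+j-j≡i : ∀ i j → i ℤ.+ j - j ≡ i
  i+j-j≡i = ℤ-Solver.solve-∀

[i-k]-[j-k]≡i-j : ∀ i j k → (i - k) - (j - k) ≡ i - j
[i-k]-[j-k]≡i-j = ℤ-Solver.solve-∀

rank-transfer : ∀ {G G′ S S′ f} (k : ℤ) → (∀ {c} → NumComponents G S c ⇔ NumComponents G′ S′ c) →
                ∣ S ∣ ≡ ∣ S′ ∣ + f →
                (∃[ r ] (Rank G S r × k ℤ.≤ + r)) ⇔ (∃[ r′ ] (Rank G′ S′ r′ × k - + f ℤ.≤ + r′))
rank-transfer {G} {G′} {S} {S′} {f} k components~ ∣S∣≡∣S′∣+f = mk⇔ forward backward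
  where
  open ≡-Reasoning

  forward : ∃[ r ] (Rank G S r × k ℤ.≤ + r) → ∃[ r′ ] (Rank G′ S′ r′ × k - + f ℤ.≤ + r′)
  forward (r , (c , components , r+c≡∣S∣) , k≤r) =
    r′ , (c , components′ , r′+c≡∣S′∣) , from i-j≤k⇔i≤k+j (subst (k ℤ.≤_) r≡r′+f k≤r)
    where
    components′ = to components~ components
    r′ = ∣ S′ ∣ ∸ c

    r′+c≡∣S′∣ : r′ + c ≡ ∣ S′ ∣
    r′+c≡∣S′∣ = ℕ.m∸n+n≡m (numComponents≤∣S∣ {G′} components′)

    r≡r′+f : + r ≡ + r′ ℤ.+ + f
    r≡r′+f = trans (cong +_ (ℕ.+-cancelʳ-≡ c r (r′ + f) (begin
      r + c         ≡⟨ r+c≡∣S∣ ⟩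
      ∣ S ∣         ≡⟨ ∣S∣≡∣S′∣+f ⟩
      ∣ S′ ∣ + f    ≡⟨ cong (_+ f) r′+c≡∣S′∣ ⟨
      r′ + c + f    ≡⟨ xy∙z≈xz∙y r′ c f ⟩
      r′ + f + c    ∎))) (ℤ.pos-+ r′ f)

  backward : ∃[ r′ ] (Rank G′ S′ r′ × k - + f ℤ.≤ + r′) → ∃[ r ] (Rank G S r × k ℤ.≤ + r)
  backward (r′ , (c , components′ , r′+c≡∣S′∣) , k-f≤r′) =
    r′ + f , (c , from components~ components′ , r′+f+c≡∣S∣) ,
    subst (k ℤ.≤_) (sym (ℤ.pos-+ r′ f)) (to i-j≤k⇔i≤k+j k-f≤r′)
    where
    r′+f+c≡∣S∣ : r′ + f + c ≡ ∣ S ∣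
    r′+f+c≡∣S∣ = begin
      r′ + f + c    ≡⟨ xy∙z≈xz∙y r′ f c ⟩
      r′ + c + f    ≡⟨ cong (_+ f) r′+c≡∣S′∣ ⟩
      ∣ S′ ∣ + f    ≡⟨ ∣S∣≡∣S′∣+f ⟨
      ∣ S ∣         ∎

-- Deleting E(XL, XR) and contracting F₂

edge-irrefl : ∀ G {u} → ¬ Edge G u u
edge-irrefl G {u} e = false≢true (trans (sym (adj-irrefl G u)) e)
  where
  false≢true : false ≢ true
  false≢true ()

edge-deleteEdges⁺ : ∀ G F {u v} → Edge (deleteEdges G F) u v → Edge G u v
edge-deleteEdges⁺ G F {u} {v} = ∧-conicalˡ (adj G u v) _

edge-deleteEdges⁻ : ∀ G F {u v} → Edge G u v →
                    Edge (deleteEdges G F) u v ⊎ F u v ≡ true ⊎ F v u ≡ true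
edge-deleteEdges⁻ G F {u} {v} e with F u v | F v u
... | true  | _     = inj₂ (inj₁ refl)
... | false | true  = inj₂ (inj₂ refl)
... | false | false = inj₁ (trans (∧-identityʳ _) e)

between⁻ : ∀ {m} {A B : Subset m} {u v} → between A B u v ≡ true → u ∈ A × v ∈ B
between⁻ {A = A} {B} {u} {v} e =
  lookup⇒[]= u A (∧-conicalˡ _ _ e) , lookup⇒[]= v B (∧-conicalʳ _ _ e)

IsSolution : (G : Graph) → ℤ → ℤ → (X XL XR Xs Ys : Subset (n G)) → Set
IsSolution G k d X XL XR Xs Ys =
  Xs ⊆ X × Ys ⊆ ∁ X
  × VertexCover G ((X ─ Xs) ∪ Ys)
  × (∃[ r ] (Rank G ((X ─ Xs) ∪ Ys) r × k ℤ.≤ + r))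
  × ((+ ∣ Ys ∣) - (+ ∣ Xs ∣) ℤ.≤ k - d)
  × Disjoint XL Xs × XR ⊆ Xs

module ContractionOfXL
  (G : Graph) (X XL XR : Subset (n G)) (valid : ValidInstance G X XL XR)
  (F₂ : List (Fin (n G) × Fin (n G))) (forest : SpanningForest G XL F₂)
  (G′ : Graph) (π : Fin (n G) → Fin (n G′))
  (contraction : IsContraction (deleteEdges G (between XL XR)) (EdgeOfList F₂) G′ π)
  where

  H : Graph
  H = deleteEdges G (between XL XR)

  onto : ∀ a → ∃[ u ] π u ≡ a
  onto = proj₁ contraction

  fibres : ∀ u v → (π u ≡ π v) ⇔ Reach (EdgeOfList F₂) u v
  fibres = proj₁ (proj₂ contraction)

  edge′ : ∀ a b → Edge G′ a b ⇔ (a ≢ b × ∃[ u ] ∃[ v ] (π u ≡ a × π v ≡ b × Edge H u v))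
  edge′ = proj₂ (proj₂ contraction)

  open Quotient π onto

  XL⊆X : XL ⊆ X
  XL⊆X = proj₁ (proj₂ valid)

  XR⊆X : XR ⊆ X
  XR⊆X = proj₁ (proj₂ (proj₂ valid))

  XR∩XL=∅ : Disjoint XR XL
  XR∩XL=∅ u u∈XR u∈XL = proj₂ (proj₂ (proj₂ valid)) u u∈XL u∈XR

  F₂⊆G[XL] : ∀ {u v} → EdgeOfList F₂ u v → EdgeIn G XL u v
  F₂⊆G[XL] (inj₁ uv∈F₂) = proj₂ (All.lookup (proj₁ (proj₂ forest)) uv∈F₂)
  F₂⊆G[XL] {u} {v} (inj₂ vu∈F₂) =
    let (_ , e , v∈XL , u∈XL) = All.lookup (proj₁ (proj₂ forest)) vu∈F₂
    in trans (adj-sym G u v) e , u∈XL , v∈XL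

  identified : ∀ {u v} → π u ≡ π v → u ≡ v ⊎ (u ∈ XL × v ∈ XL)
  identified {u} {v} πu≡πv = classes (to (fibres u v) πu≡πv)
    where
    classes : ∀ {u v} → Reach (EdgeOfList F₂) u v → u ≡ v ⊎ (u ∈ XL × v ∈ XL)
    classes here = inj₁ refl
    classes (step e p) with F₂⊆G[XL] e | classes p
    ... | _ , u∈XL , w∈XL | inj₁ refl = inj₂ (u∈XL , w∈XL)
    ... | _ , u∈XL , _ | inj₂ (_ , v∈XL) = inj₂ (u∈XL , v∈XL)

  saturated-⊇XL : ∀ {A} → XL ⊆ A → Saturated A
  saturated-⊇XL XL⊆A πu≡πv u∈A with identified πu≡πv
  ... | inj₁ refl = u∈A
  ... | inj₂ (_ , v∈XL) = XL⊆A v∈XL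

  injectiveOn-outside-XL : ∀ {A} → Disjoint A XL → InjectiveOn A
  injectiveOn-outside-XL A∩XL=∅ {u} u∈A _ πu≡πv with identified πu≡πv
  ... | inj₁ u≡v = u≡v
  ... | inj₂ (u∈XL , _) = ⊥-elim (A∩XL=∅ u u∈A u∈XL)

  saturated-outside-XL : ∀ {A} → Disjoint A XL → Saturated A
  saturated-outside-XL A∩XL=∅ {u} πu≡πv u∈A with identified πu≡πv
  ... | inj₁ refl = u∈A
  ... | inj₂ (u∈XL , _) = ⊥-elim (A∩XL=∅ u u∈A u∈XL)

  vertex-count : n G ≡ n G′ + length F₂
  vertex-count = forest-contraction-size F₂ (proj₁ forest) (All.map proj₁ (proj₁ (proj₂ forest)))
                   (proj₁ (proj₂ (proj₂ forest))) (onto , fibres)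

  ∣∣-outside-XL : ∀ {A A′} → Corresponds A A′ → Disjoint A XL → ∣ A ∣ ≡ ∣ A′ ∣
  ∣∣-outside-XL A~A′ A∩XL=∅ = ∣∣-transfer A~A′ (injectiveOn-outside-XL A∩XL=∅)

  ∣∣-⊇XL : ∀ {A A′} → Corresponds A A′ → XL ⊆ A → ∣ A ∣ ≡ ∣ A′ ∣ + length F₂
  ∣∣-⊇XL A~A′ XL⊆A = ∣∣-transfer-∁ vertex-count A~A′
    (injectiveOn-outside-XL λ u u∈∁A u∈XL → x∈∁p⇒x∉p u∈∁A (XL⊆A u∈XL))

  H-edge⇒G-edge : ∀ {u v} → Edge H u v → Edge G u v
  H-edge⇒G-edge = edge-deleteEdges⁺ G (between XL XR)

  G-edge⇒ : ∀ {u v} → Edge G u v → Edge H u v ⊎ (u ∈ XL × v ∈ XR) ⊎ (v ∈ XL × u ∈ XR)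
  G-edge⇒ e = Sum.map₂ (Sum.map between⁻ between⁻) (edge-deleteEdges⁻ G (between XL XR) e)

  contracted-edge : ∀ {u v} → Edge H u v → π u ≢ π v → Edge G′ (π u) (π v)
  contracted-edge e πu≢πv = from (edge′ _ _) (πu≢πv , _ , _ , refl , refl , e)

  module _ {S S′} (S~S′ : Corresponds S S′) (XL⊆S : XL ⊆ S) where

    vertexCover-transfer : VertexCover G S ⇔ VertexCover G′ S′
    vertexCover-transfer = mk⇔ forward backward
      where
      forward : VertexCover G S → VertexCover G′ S′
      forward cover a b e′ with to (edge′ a b) e′
      ... | _ , u , v , refl , refl , e =
        Sum.map (to (S~S′ u)) (to (S~S′ v)) (cover u v (H-edge⇒G-edge e))

      -- The edges lost by the contraction lie inside XL or join XL to XR, and XL ⊆ S covers them.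
      backward : VertexCover G′ S′ → VertexCover G S
      backward cover′ u v e with G-edge⇒ e
      ... | inj₂ (inj₁ (u∈XL , _)) = inj₁ (XL⊆S u∈XL)
      ... | inj₂ (inj₂ (v∈XL , _)) = inj₂ (XL⊆S v∈XL)
      ... | inj₁ eH with π u ≟ π v
      ...   | no πu≢πv =
        Sum.map (from (S~S′ u)) (from (S~S′ v)) (cover′ _ _ (contracted-edge eH πu≢πv))
      ...   | yes πu≡πv with identified πu≡πv
      ...     | inj₁ refl = ⊥-elim (edge-irrefl G e)
      ...     | inj₂ (u∈XL , _) = inj₁ (XL⊆S u∈XL)

    F₂⊆G[S] : ∀ {u v} → Reach (EdgeOfList F₂) u v → Reach (EdgeIn G S) u v
    F₂⊆G[S] = reach-map λ e →
      let (eG , u∈XL , v∈XL) = F₂⊆G[XL] e in eG , XL⊆S u∈XL , XL⊆S v∈XL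

    -- Inside a class of π walk along F₂; between classes use a preimage of the G′-edge.
    lift : ∀ {a b u v} → π u ≡ a → π v ≡ b → Reach (EdgeIn G′ S′) a b → Reach (EdgeIn G S) u v
    lift {u = u} {v} πu≡a πv≡a here = F₂⊆G[S] (to (fibres u v) (trans πu≡a (sym πv≡a)))
    lift {u = u} πu≡a πv≡b (step (e′ , a∈S′ , w∈S′) p) with to (edge′ _ _) e′
    ... | _ , x , y , refl , refl , eH =
      reach-trans (F₂⊆G[S] (to (fibres u x) πu≡a))
        (step (H-edge⇒G-edge eH , from (S~S′ x) a∈S′ , from (S~S′ y) w∈S′) (lift refl πv≡b p))

    reach-transfer : Disjoint XR S → ∀ {u v} → u ∈ S → v ∈ S →
                     Reach (EdgeIn G S) u v ⇔ Reach (EdgeIn G′ S′) (π u) (π v)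
    reach-transfer XR∩S=∅ _ _ = mk⇔ push (lift refl refl)
      where
      push : ∀ {u v} → Reach (EdgeIn G S) u v → Reach (EdgeIn G′ S′) (π u) (π v)
      push here = here
      push {u} {v} (step {v = w} (e , u∈S , w∈S) p) with G-edge⇒ e
      ... | inj₂ (inj₁ (_ , w∈XR)) = ⊥-elim (XR∩S=∅ w w∈XR w∈S)
      ... | inj₂ (inj₂ (_ , u∈XR)) = ⊥-elim (XR∩S=∅ u u∈XR u∈S)
      ... | inj₁ eH with π u ≟ π w
      ...   | yes πu≡πw = subst (λ a → Reach _ a (π v)) (sym πu≡πw) (push p)
      ...   | no πu≢πw =
        step (contracted-edge eH πu≢πw , to (S~S′ u) u∈S , to (S~S′ w) w∈S) (push p)

  module Solutions {X′ XL′ XR′ : Subset (n G′)}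
    (X-image : IsImage π X X′) (XL-image : IsImage π XL XL′) (XR-image : IsImage π XR XR′) where

    X~X′ : Corresponds X X′
    X~X′ = isImage⇒corresponds X-image (saturated-⊇XL XL⊆X)

    XL~XL′ : Corresponds XL XL′
    XL~XL′ = isImage⇒corresponds XL-image (saturated-⊇XL λ u∈XL → u∈XL)

    XR~XR′ : Corresponds XR XR′
    XR~XR′ = isImage⇒corresponds XR-image (saturated-outside-XL XR∩XL=∅)

    solution-saturated : ∀ k d {Xs Ys} → IsSolution G k d X XL XR Xs Ys →
                         Saturated Xs × Saturated Ys
    solution-saturated _ _ (_ , Ys⊆∁X , _ , _ , _ , XL∩Xs=∅ , _) =
      saturated-outside-XL (λ u u∈Xs u∈XL → XL∩Xs=∅ u u∈XL u∈Xs) ,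
      saturated-outside-XL (λ u u∈Ys u∈XL → x∈∁p⇒x∉p (Ys⊆∁X u∈Ys) (XL⊆X u∈XL))

    module _ {Xs Ys : Subset (n G)} {Xs′ Ys′ : Subset (n G′)}
             (Xs~Xs′ : Corresponds Xs Xs′) (Ys~Ys′ : Corresponds Ys Ys′) where

      S~S′ : Corresponds ((X ─ Xs) ∪ Ys) ((X′ ─ Xs′) ∪ Ys′)
      S~S′ = corresponds-∪ (corresponds-─ X~X′ Xs~Xs′) Ys~Ys′

      module Conditions (Ys⊆∁X : Ys ⊆ ∁ X) (XL∩Xs=∅ : Disjoint XL Xs) (XR⊆Xs : XR ⊆ Xs) where

        XL⊆S : XL ⊆ (X ─ Xs) ∪ Ys
        XL⊆S {u} u∈XL = x∈p∪q⁺ (inj₁ (x∈p∧x∉q⇒x∈p─q (XL⊆X u∈XL) (XL∩Xs=∅ u u∈XL)))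

        XR∩S=∅ : Disjoint XR ((X ─ Xs) ∪ Ys)
        XR∩S=∅ u u∈XR u∈S with x∈p∪q⁻ (X ─ Xs) Ys u∈S
        ... | inj₁ u∈X─Xs = proj₂ (to ─⇔×∉ u∈X─Xs) (XR⊆Xs u∈XR)
        ... | inj₂ u∈Ys = x∈∁p⇒x∉p (Ys⊆∁X u∈Ys) (XR⊆X u∈XR)

        cover-transfer : VertexCover G ((X ─ Xs) ∪ Ys) ⇔ VertexCover G′ ((X′ ─ Xs′) ∪ Ys′)
        cover-transfer = vertexCover-transfer S~S′ XL⊆S

        rank-condition-transfer : ∀ k →
          (∃[ r ] (Rank G ((X ─ Xs) ∪ Ys) r × k ℤ.≤ + r)) ⇔
          (∃[ r′ ] (Rank G′ ((X′ ─ Xs′) ∪ Ys′) r′ × k - + length F₂ ℤ.≤ + r′))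
        rank-condition-transfer k = rank-transfer {G} {G′} k
          (numComponents-transfer {G} {G′} onto S~S′ (reach-transfer S~S′ XL⊆S XR∩S=∅))
          (∣∣-⊇XL S~S′ XL⊆S)

        budget-transfer : ∀ k d →
          (+ ∣ Ys ∣ - + ∣ Xs ∣ ℤ.≤ k - d) ⇔
          (+ ∣ Ys′ ∣ - + ∣ Xs′ ∣ ℤ.≤ (k - + length F₂) - (d - + length F₂))
        budget-transfer k d
          rewrite ∣∣-outside-XL Xs~Xs′ (λ u u∈Xs u∈XL → XL∩Xs=∅ u u∈XL u∈Xs)
                | ∣∣-outside-XL Ys~Ys′ (λ u u∈Ys u∈XL → x∈∁p⇒x∉p (Ys⊆∁X u∈Ys) (XL⊆X u∈XL))
                | [i-k]-[j-k]≡i-j k d (+ length F₂) = ⇔-refl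

      solution-transfer : ∀ k d → IsSolution G k d X XL XR Xs Ys ⇔
                          IsSolution G′ (k - + length F₂) (d - + length F₂) X′ XL′ XR′ Xs′ Ys′
      solution-transfer k d = mk⇔ forward backward
        where
        Xs⊆X~ : Xs ⊆ X ⇔ Xs′ ⊆ X′
        Xs⊆X~ = ⊆-transfer Xs~Xs′ X~X′

        Ys⊆∁X~ : Ys ⊆ ∁ X ⇔ Ys′ ⊆ ∁ X′
        Ys⊆∁X~ = ⊆-transfer Ys~Ys′ (corresponds-∁ X~X′)

        XL∩Xs~ : Disjoint XL Xs ⇔ Disjoint XL′ Xs′
        XL∩Xs~ = disjoint-transfer XL~XL′ Xs~Xs′

        XR⊆Xs~ : XR ⊆ Xs ⇔ XR′ ⊆ Xs′
        XR⊆Xs~ = ⊆-transfer XR~XR′ Xs~Xs′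

        forward : IsSolution G k d X XL XR Xs Ys →
                  IsSolution G′ (k - + length F₂) (d - + length F₂) X′ XL′ XR′ Xs′ Ys′
        forward (Xs⊆X , Ys⊆∁X , cover , rank , budget , XL∩Xs=∅ , XR⊆Xs) =
          to Xs⊆X~ Xs⊆X , to Ys⊆∁X~ Ys⊆∁X , to cover-transfer cover ,
          to (rank-condition-transfer k) rank , to (budget-transfer k d) budget ,
          to XL∩Xs~ XL∩Xs=∅ , to XR⊆Xs~ XR⊆Xs
          where open Conditions Ys⊆∁X XL∩Xs=∅ XR⊆Xs

        backward : IsSolution G′ (k - + length F₂) (d - + length F₂) X′ XL′ XR′ Xs′ Ys′ →
                   IsSolution G k d X XL XR Xs Ys
        backward (Xs′⊆X′ , Ys′⊆∁X′ , cover , rank , budget , XL′∩Xs′=∅ , XR′⊆Xs′) =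
          from Xs⊆X~ Xs′⊆X′ , Ys⊆∁X , from cover-transfer cover ,
          from (rank-condition-transfer k) rank , from (budget-transfer k d) budget ,
          XL∩Xs=∅ , XR⊆Xs
          where
          Ys⊆∁X : Ys ⊆ ∁ X
          Ys⊆∁X = from Ys⊆∁X~ Ys′⊆∁X′

          XL∩Xs=∅ : Disjoint XL Xs
          XL∩Xs=∅ = from XL∩Xs~ XL′∩Xs′=∅

          XR⊆Xs : XR ⊆ Xs
          XR⊆Xs = from XR⊆Xs~ XR′⊆Xs′

          open Conditions Ys⊆∁X XL∩Xs=∅ XR⊆Xs

lemma14 : (G : Graph) (k d : ℕ) (X XL XR : Subset (n G)) →
    ValidInstance G X XL XR →
    (F₂ : List (Fin (n G) × Fin (n G))) → SpanningForest G XL F₂ →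
    (G' : Graph) (π : Fin (n G) → Fin (n G')) →
    IsContraction (deleteEdges G (between XL XR)) (EdgeOfList F₂) G' π →
    (X' XL' XR' : Subset (n G')) →
    IsImage π X X' → IsImage π XL XL' → IsImage π XR XR' →
    YesInstance G (+ k) (+ d) X XL XR
      ⇔ YesInstance G' (+ k - + length F₂) (+ d - + length F₂) X' XL' XR'
lemma14 G k d X XL XR valid F₂ forest G′ π contraction _ _ _ X-image XL-image XR-image =
  mk⇔ (λ (Xs , Ys , solution) →
         let (Xs-saturated , Ys-saturated) = solution-saturated (+ k) (+ d) solution in
         image Xs , image Ys ,
         to (solution-transfer (image-corresponds Xs-saturated) (image-corresponds Ys-saturated)
                               (+ k) (+ d))
            solution)
      (λ (Xs′ , Ys′ , solution′) →
         preimage Xs′ , preimage Ys′ ,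
         from (solution-transfer (preimage-corresponds Xs′) (preimage-corresponds Ys′) (+ k) (+ d))
              solution′)
  where
  open ContractionOfXL G X XL XR valid F₂ forest G′ π contraction
  open Quotient π onto
  open Solutions X-image XL-image XR-image
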